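{- Let $p$ be an odd prime, let $(r,\lambda)\in\mathbb{Z}\times\overline{\mathbb{F}}_p^\times$ with $0\le r\le p^2-2$, and let $n\ge0$ be an integer. If the non-supercuspidal $C$-parameter $\widetilde\psi_{r,\lambda}:\Gamma_{\mathbb{Q}_p}\to{}^CG$ is $n$-generic, then there exists a pair $(a,b)\in\mathbb{Z}^2$ with $n<a-b+1<p-n$ such that $\widetilde\psi_{r,\lambda}|_{\mathcal{I}_{\mathbb{Q}_p}}\simeq\tau_1(a,b)$.
   Context: $\Gamma_F$ denotes the absolute Galois group of a finite extension $F/\mathbb{Q}_p$, $\mathcal{I}_F$ its inertia subgroup; $\mathbb{Q}_{p^2}$ is the unramified quadratic extension, so $\mathcal{I}_{\mathbb{Q}_p}=\mathcal{I}_{\mathbb{Q}_{p^2}}\subset\Gamma_{\mathbb{Q}_{p^2}}$. $\varphi\in\Gamma_{\mathbb{Q}_p}$ is a fixed geometric Frobenius. The $C$-group is ${}^CG=(\mathrm{GL}_2(\overline{\mathbb{F}}_p)\times\overline{\mathbb{F}}_p^\times)\rtimes\Gamma_{\mathbb{Q}_p}$, where $\Gamma_{\mathbb{Q}_p}$ acts trivially on the $\overline{\mathbb{F}}_p^\times$ factor, $\Gamma_{\mathbb{Q}_{p^2}}$ acts trivially on $\mathrm{GL}_2(\overline{\mathbb{F}}_p)$, and $\varphi g\varphi^{ -1}=\det(g)^{ -1}g$; write ${}^C\hat G=\mathrm{GL}_2(\overline{\mathbb{F}}_p)\times\overline{\mathbb{F}}_p^\times$. Fix $\varpi_2\in\overline{\mathbb{Q}}_p$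 with $\varpi_2^{p^2-1}=p$, $\varpi_1=\varpi_2^{p+1}$, and for $n\in\{1,2\}$ let $\omega_n:\mathcal{I}_{\mathbb{Q}_p}\to\overline{\mathbb{F}}_p^\times$, $\omega_n(h)=\overline{h(\varpi_n)/\varpi_n}$, extended to $\Gamma_{\mathbb{Q}_{p^n}}$ by $\omega_n(\varphi^n)=1$ (so $\omega_1=\omega_2^{p+1}$ on inertia). For $\lambda\in\overline{\mathbb{F}}_p^\times$, $\mu_{2,\lambda}:\Gamma_{\mathbb{Q}_{p^2}}\to\overline{\mathbb{F}}_p^\times$ is unramified with $\mu_{2,\lambda}(\varphi^2)=\lambda$. The $C$-parameter $\widetilde\psi_{r,\lambda}:\Gamma_{\mathbb{Q}_p}\to{}^CG$ is the homomorphism with $\widetilde\psi_{r,\lambda}(\varphi)=((\mathrm{diag}(1,\lambda),1),\varphi)$ and, for $h\in\Gamma_{\mathbb{Q}_{p^2}}$, $\widetilde\psi_{r,\lambda}(h)=((\mathrm{diag}(\mu_{2,\lambda^{ -1}}\omega_2^r(h)\omega_1(h),\ \mu_{2,\lambda}\omega_2^{ -pr-(p+1)}(h)\omega_1(h)),\ \omega_1(h)),h)$. For a $C$-parameter $\rho$, its restriction to inertia has the form $h\mapsto(\rho_0(h),h)$ with $\rho_0:\mathcal{I}_{\mathbb{Q}_p}\to{}^C\hat G$, and we write $\rho|_{\mathcal{I}_{\mathbb{Q}_p}}$ for $\rho_0$. Two homomorphisms $\mathcal{I}_{\mathbb{Q}_p}\to{}^C\hat G$ are equivalent ($\simeq$)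 if they are conjugate by an element of ${}^C\hat G$. For $(a,b)\in\mathbb{Z}^2$ and $W=\{1,s_0\}$ the Weyl group of order $2$: $\tau_1(a,b)(h)=(\mathrm{diag}(\omega_2(h)^{a+1+p(1-b)},\omega_2(h)^{b-pa}),\omega_1(h))$ and $\tau_{s_0}(a,b)(h)=(\mathrm{diag}(\omega_2(h)^{a+1-pa},\omega_2(h)^{b+p(1-b)}),\omega_1(h))$ for $h\in\mathcal{I}_{\mathbb{Q}_p}$. A $C$-parameter $\rho$ is $n$-generic if there exist $w\in W$ and $(a,b)\in\mathbb{Z}^2$ with $n<a-b+1<p-n$ and $\rho|_{\mathcal{I}_{\mathbb{Q}_p}}\simeq\tau_w(a,b)$. -}

module Defs where

open import Level using (Level; _⊔_)
open import Algebra.Bundles using (CommutativeRing)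
open import Data.Nat as ℕ using (ℕ; zero; suc)
open import Data.Integer as ℤ using (ℤ; +_; -[1+_])
open import Data.List using (List; []; _∷_)
open import Data.Product using (Σ; ∃; ∃-syntax; _×_; _,_)
open import Relation.Nullary using (¬_)

record Mat2 {c} (A : Set c) : Set c where
  constructor mat
  field
    m11 m12 m21 m22 : A

module _ {c ℓ : Level} (K : CommutativeRing c ℓ) where
  open CommutativeRing K

  pow : Carrier → ℕ → Carrier
  pow x zero    = 1#
  pow x (suc k) = x * pow x k

  natK : ℕ → Carrier
  natK zero    = 0#
  natK (suc k) = 1# + natK k

  IsField : Set (c ⊔ ℓ)
  IsField = (¬ (1# ≈ 0#)) × (∀ x → ¬ (x ≈ 0#) → ∃[ y ] (x * y ≈ 1#))

  -- evaluation of the monic polynomial  x^(length cs) + Σ cs_i x^i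
  -- (cs lists the lower coefficients, constant term first)
  evalMonic : List Carrier → Carrier → Carrier
  evalMonic []       x = 1#
  evalMonic (a ∷ cs) x = a + x * evalMonic cs x

  IsAlgClosed : Set (c ⊔ ℓ)
  IsAlgClosed = ∀ (a : Carrier) (cs : List Carrier) → ∃[ x ] (evalMonic (a ∷ cs) x ≈ 0#)

  HasChar : ℕ → Set ℓ
  HasChar p = natK p ≈ 0#

  IsPrimitiveRoot : ℕ → Carrier → Set ℓ
  IsPrimitiveRoot N ζ = (pow ζ N ≈ 1#) × (∀ k → 0 ℕ.< k → k ℕ.< N → ¬ (pow ζ k ≈ 1#))

  -- integer powers of an N-th root of unity ζ  (ζ⁻¹ = ζ^(N-1))
  zpow : ℕ → Carrier → ℤ → Carrier
  zpow N ζ (+ k)     = pow ζ k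
  zpow N ζ -[1+ k ]  = pow (pow ζ (N ℕ.∸ 1)) (suc k)

  mmul : Mat2 Carrier → Mat2 Carrier → Mat2 Carrier
  mmul (mat a b c' d) (mat e f g h) =
    mat (a * e + b * g) (a * f + b * h) (c' * e + d * g) (c' * f + d * h)

  det : Mat2 Carrier → Carrier
  det (mat a b c' d) = a * d - b * c'

  diag : Carrier → Carrier → Mat2 Carrier
  diag x y = mat x 0# 0# y

  _≈M_ : Mat2 Carrier → Mat2 Carrier → Set ℓ
  mat a b c' d ≈M mat e f g h = (a ≈ e) × (b ≈ f) × (c' ≈ g) × (d ≈ h)

  IsUnit : Carrier → Set (c ⊔ ℓ)
  IsUnit x = ∃[ y ] (x * y ≈ 1#)

  -- Elements of  ^C Ĝ = GL₂ × 𝔾ₘ  (invertibility is imposed where needed).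
  CG : Set c
  CG = Mat2 Carrier × Carrier

  -- A tame homomorphism I_{Q_p} → ^C Ĝ factoring through ω₂ is recorded by its
  -- value at an element h₀ ∈ I_{Q_p} with ω₂(h₀) = ζ, ζ a primitive (p²-1)-th root
  -- of unity (so ω₁(h₀) = ζ^(p+1)).  Equivalence (conjugacy by an element of
  -- ^C Ĝ) of two such homomorphisms is conjugacy of these values.
  _≃C_ : CG → CG → Set (c ⊔ ℓ)
  (x , s) ≃C (y , t) =
    ∃[ g ] ∃[ u ] (IsUnit (det g) × IsUnit u ×
       (mmul g x ≈M mmul y g) × (u * s ≈ t * u))

  module Params (p : ℕ) (ζ : Carrier) where
    N : ℕ
    N = p ℕ.* p ℕ.∸ 1

    ω₂^ : ℤ → Carrier
    ω₂^ = zpow N ζ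

    ω₁ : Carrier
    ω₁ = pow ζ (suc p)

    pℤ : ℤ
    pℤ = + p

    -- ψ̃_{r,λ} restricted to inertia, evaluated at h₀:
    -- (diag(ω₂^r ω₁, ω₂^(-pr-(p+1)) ω₁), ω₁)   (μ_{2,λ^{±1}} are trivial on inertia)
    psiI : ℤ → Carrier → CG
    psiI r lam =
      ( diag (ω₂^ r * ω₁)
             (ω₂^ (ℤ.- (pℤ ℤ.* r) ℤ.- (pℤ ℤ.+ ℤ.+ 1)) * ω₁)
      , ω₁)

    tau1 : ℤ → ℤ → CG
    tau1 a b =
      ( diag (ω₂^ (a ℤ.+ ℤ.+ 1 ℤ.+ pℤ ℤ.* (ℤ.+ 1 ℤ.- b)))
             (ω₂^ (b ℤ.- pℤ ℤ.* a))
      , ω₁)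

    tauS0 : ℤ → ℤ → CG
    tauS0 a b =
      ( diag (ω₂^ (a ℤ.+ ℤ.+ 1 ℤ.- pℤ ℤ.* a))
             (ω₂^ (b ℤ.+ pℤ ℤ.* (ℤ.+ 1 ℤ.- b)))
      , ω₁)

    data W : Set where
      w1 ws0 : W

    tau : W → ℤ → ℤ → CG
    tau w1  = tau1
    tau ws0 = tauS0

    InRange : ℕ → ℤ → ℤ → Set
    InRange n a b = (+ n ℤ.< a ℤ.- b ℤ.+ ℤ.+ 1) × (a ℤ.- b ℤ.+ ℤ.+ 1 ℤ.< pℤ ℤ.- + n)

    IsGeneric : ℕ → CG → Set (c ⊔ ℓ)
    IsGeneric n ρ = ∃[ w ] ∃[ a ] ∃[ b ] (InRange n a b × (ρ ≃C tau w a b))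

{-# OPTIONS --safe #-}
-- At h₀ both ψ̃_{r,λ} and τ_{s₀}(a,b) are diagonal, and diagonal matrices conjugate
-- over a field have the same eigenvalues up to order. Writing every eigenvalue as a
-- power of ω₂(h₀) = ζ, the exponents then agree modulo p² - 1 in one of the two
-- orders; in either order an integer combination of these congruences gives
-- (p - 1)(p + 1) ∣ (p - 1)(a - b + 1), so p + 1 ∣ a - b + 1, which is impossible
-- for 0 < a - b + 1 < p. Hence genericity can only be witnessed by w = 1.
module Submission where

open import Defs
open import Algebra.Bundles using (CommutativeRing)
open import Data.Nat using (ℕ; _*_; _∸_)
open import Data.Nat.Primality using (Prime)
open import Data.Integer using (ℤ; +_; _≤_)
open import Data.Product using (∃-syntax; _×_)
open import Relation.Nullary using (¬_)
open import Relation.Binary.PropositionalEquality using (_≡_)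

import Algebra.Properties.CommutativeSemiring.Exp as Exp
import Data.Nat
open import Data.Nat using (suc; nonTrivial⇒n>1)
open import Data.Empty using (⊥)
open import Data.Integer.Properties using (≤-<-trans; <-≤-trans; ≤-trans; i-j≤i; i≤i+j)
open import Data.Integer.Divisibility.Signed
open import Data.Integer.Tactic.RingSolver using (solve-∀)
open import Data.Nat.DivMod using (_%_; _/_; m≡m%n+[m/n]*n; m%n<n)
open import Data.Nat.Divisibility using (m%n≡0⇒n∣m; >⇒∤) renaming (_∣_ to _∣ℕ_)
open import Data.Nat.Primality using (prime⇒nonTrivial)
open import Data.Product using (_,_; proj₁; proj₂)
open import Data.Sum using (_⊎_; inj₁; inj₂)
import Relation.Binary.PropositionalEquality as ≡
open import Relation.Nullary using (yes; no; contradiction)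

module _ where
  open import Data.Integer using (_+_; _-_; -_; _<_; +<+; +≤+; +[1+_]; NonZero)
    renaming (_*_ to _·_)
  open import Data.Nat using (z≤n)
  open ≡ using (sym; subst)

  0<i<j⇒j∤i : ∀ {i j} → + 0 < i → i < j → ¬ (j ∣ i)
  0<i<j⇒j∤i {+[1+ k ]} _         (+<+ 1+k<j) j∣i = >⇒∤ 1+k<j (∣⇒∣ᵤ j∣i)
  0<i<j⇒j∤i {+ 0}      (+<+ ()) _

  [i+j]-[k+l]≡[i-k]+[j-l] : ∀ i j k l → (i + j) - (k + l) ≡ (i - k) + (j - l)
  [i+j]-[k+l]≡[i-k]+[j-l] = solve-∀

  i-j≡[i-k]-[j-l]+[k-l] : ∀ i j k l → i - j ≡ ((i - k) - (j - l)) + (k - l)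
  i-j≡[i-k]-[j-l]+[k-l] = solve-∀

  -i-j·i≡-i·[1+j] : ∀ i j → - i - j · i ≡ (- i) · (+ 1 + j)
  -i-j·i≡-i·[1+j] = solve-∀

  n<d<P-n⇒P+1∤d : ∀ {n d} P → + n < d → d < P - + n → ¬ (P + + 1 ∣ d)
  n<d<P-n⇒P+1∤d {n} P n<d d<P-n = 0<i<j⇒j∤i
    (≤-<-trans (+≤+ z≤n) n<d)
    (<-≤-trans d<P-n (≤-trans (i-j≤i P (+ n)) (i≤i+j P (+ 1))))

  -- Exponents of ζ = ω₂(h₀) in the diagonal entries of ψ̃_{r,λ}(h₀) and τ_{s₀}(a,b)(h₀),
  -- using ω₁ = ω₂^(p+1).
  ψ-exponent₁ ψ-exponent₂ : ℤ → ℤ → ℤ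
  ψ-exponent₁ P r = r + (+ 1 + P)
  ψ-exponent₂ P r = (- (P · r) - (P + + 1)) + (+ 1 + P)

  τs₀-exponent₁ τs₀-exponent₂ : ℤ → ℤ → ℤ
  τs₀-exponent₁ P a = a + + 1 - P · a
  τs₀-exponent₂ P b = b + P · (+ 1 - b)

  -- Both express (P - 1)(a - b + 1) as an integer combination of P² - 1 and the
  -- differences of the exponents of eigenvalues that are matched by the conjugation.
  matched-identity : ∀ P r a b → (P - + 1) · (a - b + + 1)
    ≡ (P · P - + 1) · (a + + 1) - P · ((r + (+ 1 + P)) - (a + + 1 - P · a))
      - (((- (P · r) - (P + + 1)) + (+ 1 + P)) - (b + P · (+ 1 - b)))
  matched-identity = solve-∀

  swapped-identity : ∀ P r a b → (P - + 1) · (a - b + + 1)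
    ≡ P · ((r + (+ 1 + P)) - (b + P · (+ 1 - b)))
      + (((- (P · r) - (P + + 1)) + (+ 1 + P)) - (a + + 1 - P · a)) - (P · P - + 1) · b
  swapped-identity = solve-∀

  P²-1≡[P-1][P+1] : ∀ P → P · P - + 1 ≡ (P - + 1) · (P + + 1)
  P²-1≡[P-1][P+1] = solve-∀

  matched-exponents⇒∣ : ∀ P r a b
    → P · P - + 1 ∣ ψ-exponent₁ P r - τs₀-exponent₁ P a
    → P · P - + 1 ∣ ψ-exponent₂ P r - τs₀-exponent₂ P b
    → P · P - + 1 ∣ (P - + 1) · (a - b + + 1)
  matched-exponents⇒∣ P r a b h₁ h₂ = subst (P · P - + 1 ∣_) (sym (matched-identity P r a b))
    (∣m∣n⇒∣m-n (∣m∣n⇒∣m-n (∣m⇒∣m*n (a + + 1) ∣-refl) (∣n⇒∣m*n P h₁)) h₂)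

  swapped-exponents⇒∣ : ∀ P r a b
    → P · P - + 1 ∣ ψ-exponent₁ P r - τs₀-exponent₂ P b
    → P · P - + 1 ∣ ψ-exponent₂ P r - τs₀-exponent₁ P a
    → P · P - + 1 ∣ (P - + 1) · (a - b + + 1)
  swapped-exponents⇒∣ P r a b h₁ h₂ = subst (P · P - + 1 ∣_) (sym (swapped-identity P r a b))
    (∣m∣n⇒∣m-n (∣m∣n⇒∣m+n (∣n⇒∣m*n P h₁) h₂) (∣m⇒∣m*n b ∣-refl))

  P²-1∣[P-1]d⇒P+1∣d : ∀ P d .{{_ : NonZero (P - + 1)}}
    → P · P - + 1 ∣ (P - + 1) · d → P + + 1 ∣ d
  P²-1∣[P-1]d⇒P+1∣d P d h =
    *-cancelˡ-∣ (P - + 1) (subst (_∣ (P - + 1) · d) (P²-1≡[P-1][P+1] P) h)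

module PowerLaws {c ℓ} (K : CommutativeRing c ℓ) where
  open CommutativeRing K using (_≈_; 1#; refl; trans; *-congˡ; *-identityˡ; commutativeSemiring)
    renaming (_*_ to _·_)
  open Exp commutativeSemiring using (_^_; ^-congˡ; ^-homo-*; ^-assocʳ; ^-distrib-*)
  open import Data.Nat using (zero; suc; _+_)

  pow≡^ : ∀ x n → pow K x n ≡ x ^ n
  pow≡^ x zero    = ≡.refl
  pow≡^ x (suc n) = ≡.cong (x ·_) (pow≡^ x n)

  pow-congˡ : ∀ {x y} n → x ≈ y → pow K x n ≈ pow K y n
  pow-congˡ {x} {y} n x≈y rewrite pow≡^ x n | pow≡^ y n = ^-congˡ n x≈y

  pow-homo-* : ∀ x m n → pow K x (m + n) ≈ pow K x m · pow K x n
  pow-homo-* x m n rewrite pow≡^ x (m + n) | pow≡^ x m | pow≡^ x n = ^-homo-* x m n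

  pow-assocʳ : ∀ x m n → pow K (pow K x m) n ≈ pow K x (m * n)
  pow-assocʳ x m n rewrite pow≡^ (pow K x m) n | pow≡^ x m | pow≡^ x (m * n) = ^-assocʳ x m n

  pow-distrib-* : ∀ x y n → pow K (x · y) n ≈ pow K x n · pow K y n
  pow-distrib-* x y n rewrite pow≡^ (x · y) n | pow≡^ x n | pow≡^ y n = ^-distrib-* x y n

  pow-1# : ∀ n → pow K 1# n ≈ 1#
  pow-1# zero    = refl
  pow-1# (suc n) = trans (*-congˡ (pow-1# n)) (*-identityˡ 1#)

module RingFacts {c ℓ} (K : CommutativeRing c ℓ) where
  open CommutativeRing K renaming (_*_ to _·_)

  ¬¬-zero-product : ∀ {x y} → (¬ x ≈ 0# → ¬ y ≈ 0# → ⊥) → ¬ ¬ (x · y ≈ 0#)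
  ¬¬-zero-product {x} {y} k xy≉0 =
    k (λ x≈0 → xy≉0 (trans (*-congʳ x≈0) (zeroˡ y)))
      (λ y≈0 → xy≉0 (trans (*-congˡ y≈0) (zeroʳ x)))

  intertwined-diag-entries : ∀ {g₁₁ g₁₂ g₂₁ g₂₂ x₁ x₂ y₁ y₂}
    → _≈M_ K (mmul K (mat g₁₁ g₁₂ g₂₁ g₂₂) (diag K x₁ x₂)) (mmul K (diag K y₁ y₂) (mat g₁₁ g₁₂ g₂₁ g₂₂))
    → (g₁₁ · x₁ ≈ y₁ · g₁₁) × (g₁₂ · x₂ ≈ y₁ · g₁₂) × (g₂₁ · x₁ ≈ y₂ · g₂₁) × (g₂₂ · x₂ ≈ y₂ · g₂₂)
  intertwined-diag-entries {g₁₁} {g₁₂} {g₂₁} {g₂₂} (e₁₁ , e₁₂ , e₂₁ , e₂₂) =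
      trans (sym (drop-zeroʳ (zeroʳ g₁₂))) (trans e₁₁ (drop-zeroʳ (zeroˡ g₂₁)))
    , trans (sym (drop-zeroˡ (zeroʳ g₁₁))) (trans e₁₂ (drop-zeroʳ (zeroˡ g₂₂)))
    , trans (sym (drop-zeroʳ (zeroʳ g₂₂))) (trans e₂₁ (drop-zeroˡ (zeroˡ g₁₁)))
    , trans (sym (drop-zeroˡ (zeroʳ g₂₁))) (trans e₂₂ (drop-zeroˡ (zeroˡ g₁₂)))
    where
    drop-zeroʳ : ∀ {u z} → z ≈ 0# → u + z ≈ u
    drop-zeroʳ {u} z≈0 = trans (+-congˡ z≈0) (+-identityʳ u)
    drop-zeroˡ : ∀ {u z} → z ≈ 0# → z + u ≈ u
    drop-zeroˡ {u} z≈0 = trans (+-congʳ z≈0) (+-identityˡ u)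

module FieldFacts {c ℓ} (K : CommutativeRing c ℓ) (isField : IsField K) where
  open CommutativeRing K renaming (_*_ to _·_)
  open RingFacts K
  open import Relation.Binary.Reasoning.Setoid setoid

  unit⇒≉0 : ∀ {u} → IsUnit K u → ¬ u ≈ 0#
  unit⇒≉0 (v , uv≈1) u≈0 = proj₁ isField (trans (sym uv≈1) (trans (*-congʳ u≈0) (zeroˡ v)))

  ·-cancel-≉0 : ∀ {g x y} → ¬ g ≈ 0# → g · x ≈ y · g → x ≈ y
  ·-cancel-≉0 {g} {x} {y} g≉0 gx≈yg with proj₂ isField g g≉0
  ... | h , gh≈1 = begin
    x             ≈⟨ *-identityˡ x ⟨
    1# · x        ≈⟨ *-congʳ hg≈1 ⟨
    (h · g) · x   ≈⟨ *-assoc h g x ⟩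
    h · (g · x)   ≈⟨ *-congˡ (trans gx≈yg (*-comm y g)) ⟩
    h · (g · y)   ≈⟨ *-assoc h g y ⟨
    (h · g) · y   ≈⟨ *-congʳ hg≈1 ⟩
    1# · y        ≈⟨ *-identityˡ y ⟩
    y             ∎
    where
    hg≈1 : h · g ≈ 1#
    hg≈1 = trans (*-comm h g) gh≈1

  -- Constructively we cannot decide which entries of g vanish; double negation
  -- suffices, since the eigenvalue matching is only ever used to derive ⊥.
  intertwined-diag⇒eigenvalues-match : ∀ {g x₁ x₂ y₁ y₂} → IsUnit K (det K g)
    → _≈M_ K (mmul K g (diag K x₁ x₂)) (mmul K (diag K y₁ y₂) g)
    → ¬ ¬ ((x₁ ≈ y₁ × x₂ ≈ y₂) ⊎ (x₁ ≈ y₂ × x₂ ≈ y₁))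
  intertwined-diag⇒eigenvalues-match {mat g₁₁ g₁₂ g₂₁ g₂₂} det-unit g-intertwines no-match
    with intertwined-diag-entries g-intertwines
  ... | e₁₁ , e₁₂ , e₂₁ , e₂₂ =
    diagonal≈0 λ g₁₁g₂₂≈0 → antidiagonal≈0 λ g₁₂g₂₁≈0 →
      unit⇒≉0 det-unit (trans (+-cong g₁₁g₂₂≈0 (-‿cong g₁₂g₂₁≈0)) (-‿inverseʳ 0#))
    where
    diagonal≈0 : ¬ ¬ (g₁₁ · g₂₂ ≈ 0#)
    diagonal≈0 = ¬¬-zero-product λ g₁₁≉0 g₂₂≉0 →
      no-match (inj₁ (·-cancel-≉0 g₁₁≉0 e₁₁ , ·-cancel-≉0 g₂₂≉0 e₂₂))
    antidiagonal≈0 : ¬ ¬ (g₁₂ · g₂₁ ≈ 0#)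
    antidiagonal≈0 = ¬¬-zero-product λ g₁₂≉0 g₂₁≉0 →
      no-match (inj₂ (·-cancel-≉0 g₂₁≉0 e₂₁ , ·-cancel-≉0 g₁₂≉0 e₁₂))

module RootsOfUnity {c ℓ} (K : CommutativeRing c ℓ) (N : ℕ) .{{_ : Data.Nat.NonZero N}}
                    (ζ : CommutativeRing.Carrier K) (ζ-primitive : IsPrimitiveRoot K N ζ) where
  open CommutativeRing K using (Carrier; _≈_; 1#; setoid; refl; sym; trans; *-cong; *-comm; *-assoc; *-congˡ; *-congʳ; *-identityˡ; *-identityʳ)
    renaming (_*_ to _·_)
  open PowerLaws K
  open import Data.Nat using (suc; _+_; _≟_; >-nonZero⁻¹) renaming (_≤_ to _≤ℕ_)
  open import Data.Nat.Properties using (m+[n∸m]≡n; n≢0⇒n>0; ≤-total) renaming (*-comm to *-commℕ)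
  open import Data.Integer using (-[1+_]; -_; _⊖_; ∣_∣) renaming (_+_ to _+ℤ_; _-_ to _-ℤ_; _*_ to _·ℤ_)
  open import Data.Integer.Properties using ([+m]-[+n]≡m⊖n; ∣⊖∣-≤; ∣m⊖n∣≡∣n⊖m∣; pos-+; pos-*; +-inverseʳ)
  open import Relation.Binary.Reasoning.Setoid setoid

  ζ⁻¹ : Carrier
  ζ⁻¹ = pow K ζ (N ∸ 1)

  ζ⁻¹·ζ≈1 : ζ⁻¹ · ζ ≈ 1#
  ζ⁻¹·ζ≈1 = begin
    ζ⁻¹ · ζ              ≈⟨ *-comm ζ⁻¹ ζ ⟩
    pow K ζ (1 + (N ∸ 1)) ≡⟨ ≡.cong (pow K ζ) (m+[n∸m]≡n (>-nonZero⁻¹ N)) ⟩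
    pow K ζ N            ≈⟨ proj₁ ζ-primitive ⟩
    1#                   ∎

  pow-ζ⁻¹·pow-ζ≈1 : ∀ i → pow K ζ⁻¹ i · pow K ζ i ≈ 1#
  pow-ζ⁻¹·pow-ζ≈1 i = begin
    pow K ζ⁻¹ i · pow K ζ i ≈⟨ pow-distrib-* ζ⁻¹ ζ i ⟨
    pow K (ζ⁻¹ · ζ) i       ≈⟨ pow-congˡ i ζ⁻¹·ζ≈1 ⟩
    pow K 1# i              ≈⟨ pow-1# i ⟩
    1#                      ∎

  pow-multiple≈1 : ∀ q → pow K ζ (q * N) ≈ 1#
  pow-multiple≈1 q = begin
    pow K ζ (q * N)         ≡⟨ ≡.cong (pow K ζ) (*-commℕ q N) ⟩
    pow K ζ (N * q)         ≈⟨ pow-assocʳ ζ N q ⟨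
    pow K (pow K ζ N) q     ≈⟨ pow-congˡ q (proj₁ ζ-primitive) ⟩
    pow K 1# q              ≈⟨ pow-1# q ⟩
    1#                      ∎

  pow≈pow-mod : ∀ k → pow K ζ k ≈ pow K ζ (k % N)
  pow≈pow-mod k = begin
    pow K ζ k                                   ≡⟨ ≡.cong (pow K ζ) (m≡m%n+[m/n]*n k N) ⟩
    pow K ζ (k % N + k / N * N)                 ≈⟨ pow-homo-* ζ (k % N) (k / N * N) ⟩
    pow K ζ (k % N) · pow K ζ (k / N * N)       ≈⟨ *-congˡ (pow-multiple≈1 (k / N)) ⟩
    pow K ζ (k % N) · 1#                        ≈⟨ *-identityʳ _ ⟩
    pow K ζ (k % N)                             ∎

  pow≈1⇒∣ : ∀ k → pow K ζ k ≈ 1# → N ∣ℕ k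
  pow≈1⇒∣ k ζᵏ≈1 with k % N ≟ 0
  ... | yes k%N≡0 = m%n≡0⇒n∣m k N k%N≡0
  ... | no  k%N≢0 = contradiction (trans (sym (pow≈pow-mod k)) ζᵏ≈1)
                      (proj₂ ζ-primitive (k % N) (n≢0⇒n>0 k%N≢0) (m%n<n k N))

  pow≈pow⇒∣∸ : ∀ {i j} → i ≤ℕ j → pow K ζ i ≈ pow K ζ j → N ∣ℕ j ∸ i
  pow≈pow⇒∣∸ {i} {j} i≤j ζⁱ≈ζʲ = pow≈1⇒∣ (j ∸ i) (begin
    pow K ζ (j ∸ i)                                   ≈⟨ *-identityˡ _ ⟨
    1# · pow K ζ (j ∸ i)                              ≈⟨ *-congʳ (pow-ζ⁻¹·pow-ζ≈1 i) ⟨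
    (pow K ζ⁻¹ i · pow K ζ i) · pow K ζ (j ∸ i)       ≈⟨ *-assoc _ _ _ ⟩
    pow K ζ⁻¹ i · (pow K ζ i · pow K ζ (j ∸ i))       ≈⟨ *-congˡ (pow-homo-* ζ i (j ∸ i)) ⟨
    pow K ζ⁻¹ i · pow K ζ (i + (j ∸ i))               ≡⟨ ≡.cong (λ m → pow K ζ⁻¹ i · pow K ζ m) (m+[n∸m]≡n i≤j) ⟩
    pow K ζ⁻¹ i · pow K ζ j                           ≈⟨ *-congˡ ζⁱ≈ζʲ ⟨
    pow K ζ⁻¹ i · pow K ζ i                           ≈⟨ pow-ζ⁻¹·pow-ζ≈1 i ⟩
    1#                                                ∎)

  pow-injective-mod : ∀ i j → pow K ζ i ≈ pow K ζ j → + N ∣ + i -ℤ + j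
  pow-injective-mod i j ζⁱ≈ζʲ =
    ∣ᵤ⇒∣ (≡.subst (N ∣ℕ_) (≡.sym (≡.cong ∣_∣ ([+m]-[+n]≡m⊖n i j))) N∣∣i⊖j∣)
    where
    N∣∣i⊖j∣ : N ∣ℕ ∣ i ⊖ j ∣
    N∣∣i⊖j∣ with ≤-total i j
    ... | inj₁ i≤j = ≡.subst (N ∣ℕ_) (≡.sym (∣⊖∣-≤ i≤j)) (pow≈pow⇒∣∸ i≤j ζⁱ≈ζʲ)
    ... | inj₂ j≤i = ≡.subst (N ∣ℕ_) (≡.sym (≡.trans (∣m⊖n∣≡∣n⊖m∣ i j) (∣⊖∣-≤ j≤i)))
                       (pow≈pow⇒∣∸ j≤i (sym ζⁱ≈ζʲ))

  infix 4 _≈ζ^_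
  record _≈ζ^_ (x : Carrier) (e : ℤ) : Set ℓ where
    constructor _by_,_
    field
      exponent : ℕ
      x≈ζ^exponent : x ≈ pow K ζ exponent
      N∣e-exponent : + N ∣ e -ℤ + exponent

  pow-≈ζ^ : ∀ m → pow K ζ m ≈ζ^ + m
  pow-≈ζ^ m = m by refl , divides (+ 0) (+-inverseʳ (+ m))

  zpow-≈ζ^ : ∀ e → zpow K N ζ e ≈ζ^ e
  zpow-≈ζ^ (+ m)      = pow-≈ζ^ m
  zpow-≈ζ^ -[1+ k ]   = ((N ∸ 1) * suc k) by pow-assocʳ ζ (N ∸ 1) (suc k) , divides (- + suc k)
    (≡.trans (≡.cong (-[1+ k ] -ℤ_) (pos-* (N ∸ 1) (suc k)))
      (≡.trans (-i-j·i≡-i·[1+j] (+ suc k) (+ (N ∸ 1)))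
        (≡.cong (λ n → (- + suc k) ·ℤ + n) (m+[n∸m]≡n (>-nonZero⁻¹ N)))))

  ·-≈ζ^ : ∀ {x y e f} → x ≈ζ^ e → y ≈ζ^ f → x · y ≈ζ^ (e +ℤ f)
  ·-≈ζ^ {e = e} {f} (m by x≈ζᵐ , N∣e-m) (n by y≈ζⁿ , N∣f-n) =
    (m + n) by trans (*-cong x≈ζᵐ y≈ζⁿ) (sym (pow-homo-* ζ m n)) ,
    ≡.subst (+ N ∣_) (≡.sym (≡.trans (≡.cong ((e +ℤ f) -ℤ_) (pos-+ m n))
                               ([i+j]-[k+l]≡[i-k]+[j-l] e f (+ m) (+ n))))
      (∣m∣n⇒∣m+n N∣e-m N∣f-n)

  ≈ζ^-injective-mod : ∀ {x y e f} → x ≈ζ^ e → y ≈ζ^ f → x ≈ y → + N ∣ e -ℤ f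
  ≈ζ^-injective-mod {e = e} {f} (m by x≈ζᵐ , N∣e-m) (n by y≈ζⁿ , N∣f-n) x≈y =
    ≡.subst (+ N ∣_) (≡.sym (i-j≡[i-k]-[j-l]+[k-l] e f (+ m) (+ n)))
      (∣m∣n⇒∣m+n (∣m∣n⇒∣m-n N∣e-m N∣f-n)
        (pow-injective-mod m n (trans (sym x≈ζᵐ) (trans x≈y y≈ζⁿ))))

ψ̃≄τs₀ : ∀ {c ℓ} (K : CommutativeRing c ℓ) → IsField K
  → (p : ℕ) → 1 Data.Nat.< p
  → (ζ : CommutativeRing.Carrier K) → IsPrimitiveRoot K (p * p ∸ 1) ζ
  → ∀ r lam n a b → Params.InRange K p ζ n a b
  → ¬ _≃C_ K (Params.psiI K p ζ r lam) (Params.tauS0 K p ζ a b)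
ψ̃≄τs₀ _ _ 0 () _ _ _ _ _ _ _ _
ψ̃≄τs₀ _ _ 1 (Data.Nat.s≤s ()) _ _ _ _ _ _ _ _
ψ̃≄τs₀ K isField p@(suc (suc _)) _ ζ ζ-primitive r _ n a b (n<d , d<p-n)
      (g , _ , det-unit , _ , g-intertwines , _) =
  intertwined-diag⇒eigenvalues-match det-unit g-intertwines λ where
    (inj₁ (x₁≈y₁ , x₂≈y₂)) → n<d<P-n⇒P+1∤d (+ p) n<d d<p-n (P²-1∣[P-1]d⇒P+1∣d (+ p) _
      (matched-exponents⇒∣ (+ p) r a b
        (≈ζ^-injective-mod ψ₁ τs₀₁ x₁≈y₁) (≈ζ^-injective-mod ψ₂ τs₀₂ x₂≈y₂)))
    (inj₂ (x₁≈y₂ , x₂≈y₁)) → n<d<P-n⇒P+1∤d (+ p) n<d d<p-n (P²-1∣[P-1]d⇒P+1∣d (+ p) _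
      (swapped-exponents⇒∣ (+ p) r a b
        (≈ζ^-injective-mod ψ₁ τs₀₂ x₁≈y₂) (≈ζ^-injective-mod ψ₂ τs₀₁ x₂≈y₁)))
  where
  open CommutativeRing K using () renaming (_*_ to _·_)
  open FieldFacts K isField
  open RootsOfUnity K (p * p ∸ 1) ζ ζ-primitive
  open Params K p ζ using (ω₂^; ω₁)
  open import Data.Integer using (_+_; _-_; -_) renaming (_*_ to _·ℤ_)

  ψ₁ : ω₂^ r · ω₁ ≈ζ^ ψ-exponent₁ (+ p) r
  ψ₁ = ·-≈ζ^ (zpow-≈ζ^ r) (pow-≈ζ^ (suc p))
  ψ₂ : ω₂^ (- (+ p ·ℤ r) - (+ p + + 1)) · ω₁ ≈ζ^ ψ-exponent₂ (+ p) r
  ψ₂ = ·-≈ζ^ (zpow-≈ζ^ (- (+ p ·ℤ r) - (+ p + + 1))) (pow-≈ζ^ (suc p))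
  τs₀₁ : ω₂^ (τs₀-exponent₁ (+ p) a) ≈ζ^ τs₀-exponent₁ (+ p) a
  τs₀₁ = zpow-≈ζ^ (τs₀-exponent₁ (+ p) a)
  τs₀₂ : ω₂^ (τs₀-exponent₂ (+ p) b) ≈ζ^ τs₀-exponent₂ (+ p) b
  τs₀₂ = zpow-≈ζ^ (τs₀-exponent₂ (+ p) b)

mainTheorem5 : ∀ {c ℓ} (K : CommutativeRing c ℓ)
    → IsField K → IsAlgClosed K
    → (p : ℕ) → Prime p → ¬ (p ≡ 2) → HasChar K p
    → (ζ : CommutativeRing.Carrier K) → IsPrimitiveRoot K (p * p ∸ 1) ζ
    → (r : ℤ) → (lam : CommutativeRing.Carrier K)
    → ¬ (CommutativeRing._≈_ K lam (CommutativeRing.0# K))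
    → + 0 ≤ r → r ≤ + (p * p ∸ 2)
    → (n : ℕ)
    → Params.IsGeneric K p ζ n (Params.psiI K p ζ r lam)
    → ∃[ a ] ∃[ b ] (Params.InRange K p ζ n a b
         × _≃C_ K (Params.psiI K p ζ r lam) (Params.tau1 K p ζ a b))
mainTheorem5 _ _ _ _ _ _ _ _ _ _ _ _ _ _ _ (Params.w1 , a , b , in-range , ψ̃≃τ₁) =
  a , b , in-range , ψ̃≃τ₁
mainTheorem5 K isField _ p p-prime _ _ ζ ζ-primitive r lam _ _ _ n
             (Params.ws0 , a , b , in-range , ψ̃≃τs₀) =
  contradiction ψ̃≃τs₀
    (ψ̃≄τs₀ K isField p (nonTrivial⇒n>1 p {{prime⇒nonTrivial p-prime}}) ζ ζ-primitive
       r lam n a b in-range)
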